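{- For every integer $k\ge 1$, $R_\ell(K_3,k)>2^{k/2}$.
   Context: $K_n$ is the complete graph on $n$ vertices and $K_3$ the triangle. For a list assignment $L:E(K_n)\to\binom{\mathbb N}{k}$ (each edge receives a set of $k$ colors), an $L$-coloring is an edge-coloring in which each edge $e$ receives a color from $L(e)$. The $k$-color list Ramsey number $R_\ell(H,k)$ is the smallest $n$ such that there exists $L:E(K_n)\to\binom{\mathbb N}{k}$ for which every $L$-coloring of $K_n$ contains a monochromatic copy of $H$. -}

module Defs where

open import Data.Nat using (ℕ; _<_)
open import Data.Fin using (Fin) renaming (_<_ to _<ᶠ_)
open import Data.List using (List; length)
open import Data.List.Relation.Unary.Unique.Propositional using (Unique)
open import Data.List.Membership.Propositional using (_∈_)
open import Data.Product using (Σ; ∃; _×_)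
open import Relation.Binary.PropositionalEquality using (_≡_)

-- Edges of K_n are the pairs {i , j} with i < j (i j : Fin n).
-- A list assignment gives each edge a list of colours (colours are ℕ);
-- only the values L i j with i < j matter.
ListAssignment : ℕ → Set
ListAssignment n = Fin n → Fin n → List ℕ

IsKList : (k n : ℕ) → ListAssignment n → Set
IsKList k n L = ∀ (i j : Fin n) → i <ᶠ j → Unique (L i j) × length (L i j) ≡ k

EdgeColouring : ℕ → Set
EdgeColouring n = Fin n → Fin n → ℕ

IsLColouring : (n : ℕ) → ListAssignment n → EdgeColouring n → Set
IsLColouring n L c = ∀ (i j : Fin n) → i <ᶠ j → c i j ∈ L i j

HasMonoTriangle : (n : ℕ) → EdgeColouring n → Set
HasMonoTriangle n c =
  Σ (Fin n) λ i → Σ (Fin n) λ j → Σ (Fin n) λ l →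
    i <ᶠ j × j <ᶠ l × c i j ≡ c i l × c i j ≡ c j l

-- n is "list-Ramsey" for (K_3, k): some k-list assignment L on K_n
-- forces a monochromatic triangle in every L-colouring.
-- R_ℓ(K_3,k) is the least such n.
ListRamseyK3 : (k n : ℕ) → Set
ListRamseyK3 k n =
  Σ (ListAssignment n) λ L → IsKList k n L ×
    (∀ (c : EdgeColouring n) → IsLColouring n L c → HasMonoTriangle n c)

-- Give every vertex v a 2-colouring S v : ℕ → Bool of the colours.  If every edge uv has a colour
-- d ∈ L(uv) with S u d ≢ S v d, then colouring uv by such a d leaves no monochromatic triangle:
-- the three values S u d, S v d, S w d would be pairwise distinct Booleans.  When n ≤ 2^k such an S
-- exists: choosing S vertex by vertex, the requirements on a new vertex are fewer than 2^k clauses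
-- over k distinct variables, and by the Erdős–Selfridge argument (the derandomised union bound:
-- fix the variables one by one, keeping Σ_C 2^(-|C|) < 1) they are simultaneously satisfiable.
-- Hence R_ℓ(K₃,k) > 2^k, which is more than the claimed bound.
module Submission where

open import Defs
open import Data.Nat using (ℕ; zero; suc; _+_; _*_; _∸_; _^_; _≤_; _<_; z≤n; s≤s; _≟_; _<?_; _≤?_; >-nonZero)
open import Data.Nat.Properties
open import Algebra.Properties.CommutativeSemigroup +-commutativeSemigroup using (interchange)
open import Data.Bool using (Bool; true; false; if_then_else_)
open import Data.Bool.Properties using (¬-not) renaming (_≟_ to _≟ᵇ_)
open import Data.Fin using (Fin; zero; suc) renaming (_<_ to _<ᶠ_; _<?_ to _<ᶠ?_)
import Data.Fin.Properties as Fin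
open import Data.List using (List; []; _∷_; [_]; _++_; length; map; filter; concatMap; tabulate)
open import Data.List.Properties using (map-++; length-tabulate; filter-all; filter-accept; filter-reject)
open import Data.Nat.ListAction using (sum)
open import Data.Nat.ListAction.Properties using (sum-++)
open import Data.List.Relation.Unary.All as All using (All; []; _∷_)
open import Data.List.Relation.Unary.All.Properties using (++⁺; ++⁻ˡ; ++⁻ʳ; tabulate⁺; tabulate⁻)
open import Data.List.Relation.Unary.Any using (here; there)
open import Data.List.Relation.Unary.Unique.Propositional using (Unique; _∷_)
open import Data.List.Relation.Unary.Unique.Propositional.Properties using (filter⁺)
open import Data.List.Membership.Propositional using (_∈_; _∉_)
open import Data.List.Membership.Propositional.Properties using (∈-filter⁻)
open import Data.List.Membership.DecPropositional _≟_ using (_∈?_)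
open import Data.List.Relation.Binary.Subset.Propositional using (_⊆_)
open import Data.List.Relation.Binary.Subset.Propositional.Properties using (⊆-trans; ⊆[]⇒≡[]; xs⊆xs++ys; xs⊆ys++xs)
open import Data.Product using (∃; ∃-syntax; _×_; _,_; proj₁; proj₂)
open import Data.Sum using (_⊎_; inj₁; inj₂)
open import Function using (_∘_)
open import Relation.Nullary using (¬_; yes; no; does; ¬?; contradiction)
open import Relation.Binary.PropositionalEquality using (_≡_; _≢_; refl; sym; trans; cong; cong₂; subst; module ≡-Reasoning)

record Clause : Set where
  constructor clause
  field
    vars      : List ℕ
    falsifier : ℕ → Bool

open Clause

Satisfies : (ℕ → Bool) → Clause → Set
Satisfies s (clause L t) = ∃ λ d → d ∈ L × s d ≢ t d

-- 2^k times the probability that a uniformly random assignment falsifies the clause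
-- (an overestimate once the clause has more than k variables).
weight : ℕ → Clause → ℕ
weight k C = 2 ^ (k ∸ length (vars C))

totalWeight : ℕ → List Clause → ℕ
totalWeight k cs = sum (map (weight k) cs)

totalWeight-++ : ∀ k cs ds → totalWeight k (cs ++ ds) ≡ totalWeight k cs + totalWeight k ds
totalWeight-++ k cs ds = trans (cong sum (map-++ (weight k) cs ds)) (sum-++ (map (weight k) cs) _)

update : (ℕ → Bool) → ℕ → Bool → ℕ → Bool
update s c b d with d ≟ c
... | yes _ = b
... | no _  = s d

update-≡ : ∀ s c b → update s c b c ≡ b
update-≡ s c b with c ≟ c
... | yes _  = refl
... | no c≢c = contradiction refl c≢c

update-≢ : ∀ s c b {d} → d ≢ c → update s c b d ≡ s d
update-≢ s c b {d} d≢c with d ≟ c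
... | yes d≡c = contradiction d≡c d≢c
... | no _    = refl

remove : ℕ → List ℕ → List ℕ
remove c = filter (λ x → ¬? (x ≟ c))

remove-⊆ : ∀ c L → remove c L ⊆ L
remove-⊆ c L = proj₁ ∘ ∈-filter⁻ (λ x → ¬? (x ≟ c)) {xs = L}

∉-remove : ∀ c L → c ∉ remove c L
∉-remove c L c∈ = proj₂ (∈-filter⁻ (λ x → ¬? (x ≟ c)) {xs = L} c∈) refl

length-remove : ∀ {c L} → Unique L → c ∈ L → length L ≡ suc (length (remove c L))
length-remove {c} {_ ∷ L} (c∉L ∷ _) (here refl) =
  cong suc (begin
    length L                ≡⟨ cong length (filter-all (λ x → ¬? (x ≟ c)) (All.map (_∘ sym) c∉L)) ⟨
    length (remove c L)     ≡⟨ cong length (filter-reject (λ x → ¬? (x ≟ c)) (λ c≢c → c≢c refl)) ⟨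
    length (remove c (c ∷ L)) ∎)
  where open ≡-Reasoning
length-remove {c} {x ∷ L} (x∉L ∷ u) (there c∈L) = begin
  suc (length L)                  ≡⟨ cong suc (length-remove u c∈L) ⟩
  suc (length (x ∷ remove c L))   ≡⟨ cong (suc ∘ length) (filter-accept (λ y → ¬? (y ≟ c)) {xs = L} x≢c) ⟨
  suc (length (remove c (x ∷ L))) ∎
  where
    open ≡-Reasoning
    x≢c : x ≢ c
    x≢c refl = All.lookup x∉L c∈L refl

residual : ℕ → Bool → Clause → List Clause
residual c b (clause L t) with c ∈? L
... | no _  = [ clause L t ]
... | yes _ = if does (t c ≟ᵇ b) then [ clause (remove c L) t ] else []

assign : ℕ → Bool → List Clause → List Clause
assign c b = concatMap (residual c b)

residual-sound : ∀ {s} c b C → All (Satisfies s) (residual c b C) → Satisfies (update s c b) C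
residual-sound {s} c b (clause L t) sat with c ∈? L
residual-sound {s} c b (clause L t) ((d , d∈L , sd≢td) ∷ []) | no c∉L =
  d , d∈L , λ eq → sd≢td (trans (sym (update-≢ s c b (λ { refl → c∉L d∈L }))) eq)
... | yes c∈L with t c ≟ᵇ b | sat
... | yes _ | (d , d∈L-c , sd≢td) ∷ [] =
  let d∈L , d≢c = ∈-filter⁻ (λ x → ¬? (x ≟ c)) d∈L-c
  in d , d∈L , λ eq → sd≢td (trans (sym (update-≢ s c b d≢c)) eq)
... | no tc≢b | [] = c , c∈L , λ eq → tc≢b (trans (sym eq) (update-≡ s c b))

assign-sound : ∀ {s} c b cs → All (Satisfies s) (assign c b cs) → All (Satisfies (update s c b)) cs
assign-sound c b []       _   = []
assign-sound c b (C ∷ cs) sat =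
  residual-sound c b C (++⁻ˡ (residual c b C) sat) ∷ assign-sound c b cs (++⁻ʳ (residual c b C) sat)

k∸m≤1+k∸[1+m] : ∀ k m → k ∸ m ≤ suc (k ∸ suc m)
k∸m≤1+k∸[1+m] zero    zero    = z≤n
k∸m≤1+k∸[1+m] zero    (suc m) = z≤n
k∸m≤1+k∸[1+m] (suc k) zero    = ≤-refl
k∸m≤1+k∸[1+m] (suc k) (suc m) = k∸m≤1+k∸[1+m] k m

2^[k∸m]≤2^[k∸1+m]+2^[k∸1+m] : ∀ k m → 2 ^ (k ∸ m) ≤ 2 ^ (k ∸ suc m) + 2 ^ (k ∸ suc m)
2^[k∸m]≤2^[k∸1+m]+2^[k∸1+m] k m = begin
  2 ^ (k ∸ m)                            ≤⟨ ^-monoʳ-≤ 2 (k∸m≤1+k∸[1+m] k m) ⟩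
  2 * 2 ^ (k ∸ suc m)                    ≡⟨ cong (2 ^ (k ∸ suc m) +_) (+-identityʳ _) ⟩
  2 ^ (k ∸ suc m) + 2 ^ (k ∸ suc m)      ∎
  where open ≤-Reasoning

remove-weight : ∀ k {c L} t → Unique L → c ∈ L →
  weight k (clause (remove c L) t) ≤ weight k (clause L t) + weight k (clause L t)
remove-weight k {c} {L} t u c∈L rewrite length-remove u c∈L =
  2^[k∸m]≤2^[k∸1+m]+2^[k∸1+m] k (length (remove c L))

-- The expected weight does not grow under a uniformly random choice of x_c.
residual-weight : ∀ k c C → Unique (vars C) →
  totalWeight k (residual c false C) + totalWeight k (residual c true C) ≤ weight k C + weight k C
residual-weight k c (clause L t) u with c ∈? L
... | no _    = ≤-reflexive (cong₂ _+_ (+-identityʳ (weight k (clause L t))) (+-identityʳ _))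
... | yes c∈L with t c
...   | false = subst (_≤ _) (sym (trans (+-identityʳ _) (+-identityʳ _))) (remove-weight k t u c∈L)
...   | true  = subst (_≤ _) (sym (+-identityʳ _)) (remove-weight k t u c∈L)

assign-weight : ∀ k c cs → All (Unique ∘ vars) cs →
  totalWeight k (assign c false cs) + totalWeight k (assign c true cs) ≤ totalWeight k cs + totalWeight k cs
assign-weight k c []       []       = z≤n
assign-weight k c (C ∷ cs) (u ∷ us) = begin
  W (residual c false C ++ F) + W (residual c true C ++ T)
    ≡⟨ cong₂ _+_ (totalWeight-++ k (residual c false C) F) (totalWeight-++ k (residual c true C) T) ⟩
  (W (residual c false C) + W F) + (W (residual c true C) + W T)
    ≡⟨ interchange (W (residual c false C)) (W F) _ _ ⟩
  (W (residual c false C) + W (residual c true C)) + (W F + W T)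
    ≤⟨ +-mono-≤ (residual-weight k c C u) (assign-weight k c cs us) ⟩
  (weight k C + weight k C) + (W cs + W cs)
    ≡⟨ interchange (weight k C) (weight k C) (W cs) (W cs) ⟩
  (weight k C + W cs) + (weight k C + W cs) ∎
  where
    open ≤-Reasoning
    W : List Clause → ℕ
    W = totalWeight k
    F T : List Clause
    F = assign c false cs
    T = assign c true cs

a+b≤x+x∧x<y⇒a<y⊎b<y : ∀ {a b x y} → a + b ≤ x + x → x < y → a < y ⊎ b < y
a+b≤x+x∧x<y⇒a<y⊎b<y {a} {b} {x} {y} a+b≤x+x x<y with a <? y | b <? y
... | yes a<y | _       = inj₁ a<y
... | no _    | yes b<y = inj₂ b<y
... | no a≮y  | no b≮y  =
  contradiction (≤-<-trans a+b≤x+x (+-mono-< x<y x<y)) (≤⇒≯ (+-mono-≤ (≮⇒≥ a≮y) (≮⇒≥ b≮y)))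

assign-light : ∀ k c cs → All (Unique ∘ vars) cs → totalWeight k cs < 2 ^ k →
  ∃[ b ] totalWeight k (assign c b cs) < 2 ^ k
assign-light k c cs us light with a+b≤x+x∧x<y⇒a<y⊎b<y (assign-weight k c cs us) light
... | inj₁ light′ = false , light′
... | inj₂ light′ = true  , light′

WellFormed : List ℕ → Clause → Set
WellFormed vs C = Unique (vars C) × vars C ⊆ vs

⊆∷⇒⊆ : ∀ {c} {xs ys : List ℕ} → c ∉ xs → xs ⊆ c ∷ ys → xs ⊆ ys
⊆∷⇒⊆ c∉xs xs⊆c∷ys x∈xs with xs⊆c∷ys x∈xs
... | here refl  = contradiction x∈xs c∉xs
... | there x∈ys = x∈ys

residual-wellFormed : ∀ c b {vs} C → WellFormed (c ∷ vs) C → All (WellFormed vs) (residual c b C)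
residual-wellFormed c b (clause L t) (u , L⊆c∷vs) with c ∈? L
... | no c∉L = (u , ⊆∷⇒⊆ c∉L L⊆c∷vs) ∷ []
... | yes _ with does (t c ≟ᵇ b)
...   | true  = (filter⁺ (λ x → ¬? (x ≟ c)) u , ⊆∷⇒⊆ (∉-remove c L) (⊆-trans (remove-⊆ c L) L⊆c∷vs)) ∷ []
...   | false = []

assign-wellFormed : ∀ c b {vs} cs → All (WellFormed (c ∷ vs)) cs → All (WellFormed vs) (assign c b cs)
assign-wellFormed c b []       []         = []
assign-wellFormed c b (C ∷ cs) (wf ∷ wfs) = ++⁺ (residual-wellFormed c b C wf) (assign-wellFormed c b cs wfs)

satisfiable-over : ∀ k vs cs → All (WellFormed vs) cs → totalWeight k cs < 2 ^ k →
  ∃ λ s → All (Satisfies s) cs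
satisfiable-over k []       []       _                 _     = (λ _ → false) , []
satisfiable-over k []       (C ∷ cs) ((_ , C⊆[]) ∷ _) light = contradiction light (≤⇒≯ heavy)
  where
    heavy : 2 ^ k ≤ totalWeight k (C ∷ cs)
    heavy = subst (λ L → 2 ^ (k ∸ length L) ≤ totalWeight k (C ∷ cs)) (⊆[]⇒≡[] C⊆[])
                  (m≤m+n (weight k C) (totalWeight k cs))
satisfiable-over k (c ∷ vs) cs wfs light =
  let b , light′ = assign-light k c cs (All.map proj₁ wfs) light
      s , sat    = satisfiable-over k vs (assign c b cs) (assign-wellFormed c b cs wfs) light′
  in update s c b , assign-sound c b cs sat

wellFormed-over-concatMap : ∀ cs → All (Unique ∘ vars) cs → All (WellFormed (concatMap vars cs)) cs
wellFormed-over-concatMap []       []       = []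
wellFormed-over-concatMap (C ∷ cs) (u ∷ us) =
  (u , xs⊆xs++ys (vars C) _)
  ∷ All.map (λ (u′ , ⊆vs) → u′ , λ {_} → xs⊆ys++xs _ (vars C) ∘ ⊆vs) (wellFormed-over-concatMap cs us)

weight<2^k⇒satisfiable : ∀ k cs → All (Unique ∘ vars) cs → totalWeight k cs < 2 ^ k →
  ∃ λ s → All (Satisfies s) cs
weight<2^k⇒satisfiable k cs us = satisfiable-over k (concatMap vars cs) cs (wellFormed-over-concatMap cs us)

Separating : (n : ℕ) → ListAssignment n → (Fin n → ℕ → Bool) → Set
Separating n L S = ∀ i j → i <ᶠ j → Satisfies (S i) (clause (L i j) (S j))

totalWeight-uniform : ∀ k cs → All (λ C → length (vars C) ≡ k) cs → totalWeight k cs ≡ length cs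
totalWeight-uniform k []       []         = refl
totalWeight-uniform k (C ∷ cs) (len ∷ lens) rewrite len | n∸n≡0 k = cong suc (totalWeight-uniform k cs lens)

separating-exists : ∀ k n L → IsKList k n L → n ≤ 2 ^ k → ∃ (Separating n L)
separating-exists k zero    L _   _        = (λ ()) , λ ()
separating-exists k (suc m) L isK 1+m≤2^k = S , separating
  where
    L⁺ : ListAssignment m
    L⁺ i j = L (suc i) (suc j)

    tail-separated : ∃ (Separating m L⁺)
    tail-separated = separating-exists k m L⁺ (λ i j i<j → isK (suc i) (suc j) (s≤s i<j)) (<⇒≤ 1+m≤2^k)

    requirements : List Clause
    requirements = tabulate λ j → clause (L zero (suc j)) (proj₁ tail-separated j)

    light : totalWeight k requirements < 2 ^ k
    light = subst (_< 2 ^ k)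
      (sym (trans (totalWeight-uniform k requirements (tabulate⁺ λ j → proj₂ (isK zero (suc j) (s≤s z≤n))))
                  (length-tabulate _)))
      1+m≤2^k

    head-label : ∃ λ s → All (Satisfies s) requirements
    head-label = weight<2^k⇒satisfiable k requirements
      (tabulate⁺ λ j → proj₁ (isK zero (suc j) (s≤s z≤n))) light

    S : Fin (suc m) → ℕ → Bool
    S zero    = proj₁ head-label
    S (suc i) = proj₁ tail-separated i

    separating : Separating (suc m) L S
    separating zero    (suc j) _         = tabulate⁻ (proj₂ head-label) j
    separating (suc i) (suc j) (s≤s i<j) = proj₂ tail-separated i j i<j

module _ {n} {L : ListAssignment n} {S : Fin n → ℕ → Bool} (separating : Separating n L S) where

  separatingColouring : EdgeColouring n
  separatingColouring i j with i <ᶠ? j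
  ... | yes i<j = proj₁ (separating i j i<j)
  ... | no _    = 0

  separatingColouring-separates : ∀ i j → i <ᶠ j →
    separatingColouring i j ∈ L i j × S i (separatingColouring i j) ≢ S j (separatingColouring i j)
  separatingColouring-separates i j i<j with i <ᶠ? j
  ... | yes i<j′ = proj₂ (separating i j i<j′)
  ... | no i≮j   = contradiction i<j i≮j

  separatingColouring-isLColouring : IsLColouring n L separatingColouring
  separatingColouring-isLColouring i j = proj₁ ∘ separatingColouring-separates i j

  separatingColouring-triangleFree : ¬ HasMonoTriangle n separatingColouring
  separatingColouring-triangleFree (i , j , l , i<j , j<l , cij≡cil , cij≡cjl) =
    Sj≢Sl (trans (¬-not (Si≢Sj ∘ sym)) (sym (¬-not (Si≢Sl ∘ sym))))
    where
      d : ℕ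
      d = separatingColouring i j
      sep : ∀ a b → a <ᶠ b → S a (separatingColouring a b) ≢ S b (separatingColouring a b)
      sep a b = proj₂ ∘ separatingColouring-separates a b
      Si≢Sj : S i d ≢ S j d
      Si≢Sj = sep i j i<j
      Si≢Sl : S i d ≢ S l d
      Si≢Sl = subst (λ e → S i e ≢ S l e) (sym cij≡cil) (sep i l (Fin.<-trans i<j j<l))
      Sj≢Sl : S j d ≢ S l d
      Sj≢Sl = subst (λ e → S j e ≢ S l e) (sym cij≡cjl) (sep j l j<l)

listRamseyK3⇒2^k<n : ∀ k n → ListRamseyK3 k n → 2 ^ k < n
listRamseyK3⇒2^k<n k n (L , isK , forced) with n ≤? 2 ^ k
... | no n≰2^k = ≰⇒> n≰2^k
... | yes n≤2^k =
  let S , separating = separating-exists k n L isK n≤2^k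
  in contradiction (forced (separatingColouring separating) (separatingColouring-isLColouring separating))
                   (separatingColouring-triangleFree separating)

proposition3 : ∀ (k : ℕ) → 1 ≤ k → ∀ (n : ℕ) → ListRamseyK3 k n → 2 ^ k < n * n
proposition3 k _ n ramsey with 2^k<n ← listRamseyK3⇒2^k<n k n ramsey =
  <-≤-trans 2^k<n (m≤m*n n n {{>-nonZero (≤-<-trans z≤n 2^k<n)}})
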